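{- For any graph $G$ with source $s$, a linear order $L$ of $V(G)$ is a linearization of $G$ if and only if there exist nonnegative edge weights $w$ such that (1) for every two vertices $u\neq v$, $d_w(s,u)\neq d_w(s,v)$, and (2) $u\prec_L v$ if and only if $d_w(s,u)<d_w(s,v)$.
   Context: $G$ is a directed or undirected graph with source $s$; undirected graphs are connected, and in directed graphs every vertex is reachable from $s$. A spanning tree of an undirected $G$ is any spanning tree, rooted at $s$; in a directed $G$ it is a spanning tree rooted at $s$ with all edges directed away from $s$. For a rooted tree $T$, a linearization of $T$ is a linear order of $V(T)$ such that whenever $u$ precedes $v$, $u$ is not a descendant of $v$. A linear order $L$ of $V(G)$ is a linearization of $G$ if it is a linearization of some spanning tree of $G$. $u\prec_L v$ means $u$ precedes $v$ in $L$; $d_w$ is the shortest-path distance under $w$.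
   Formalization: The nonnegative edge weights w take rational values. -}

module Defs where

open import Level using (0ℓ)
open import Data.Nat using (ℕ)
open import Data.Bool using (Bool; true; false)
open import Data.Fin using (Fin)
open import Data.Product using (Σ; _×_; ∃; _,_)
open import Data.Sum using (_⊎_)
open import Data.Rational using (ℚ; 0ℚ; _+_; _≤_; _<_)
open import Relation.Binary.PropositionalEquality using (_≡_; _≢_)
open import Relation.Nullary using (¬_)
open import Relation.Binary using (Rel)
open import Relation.Binary.Structures using (IsStrictTotalOrder)
open import Function.Bundles using (_⇔_)

-- If directed = false, an edge may be traversed in both directions.
record Graph : Set where
  field
    n        : ℕ
    m        : ℕ
    directed : Bool
    src      : Fin m → Fin n
    tgt      : Fin m → Fin n
    s        : Fin n

open Graph public

Step : (G : Graph) → Fin (m G) → Fin (n G) → Fin (n G) → Set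
Step G e u v = (src G e ≡ u × tgt G e ≡ v) ⊎ (directed G ≡ false × src G e ≡ v × tgt G e ≡ u)

data Walk (G : Graph) : Fin (n G) → Fin (n G) → Set where
  []  : ∀ {u} → Walk G u u
  _∷_ : ∀ {u v x} → (Σ (Fin (m G)) λ e → Step G e u v) → Walk G v x → Walk G u x

AllReachable : Graph → Set
AllReachable G = ∀ (v : Fin (n G)) → Walk G (s G) v

Weights : Graph → Set
Weights G = Fin (m G) → ℚ

NonNeg : (G : Graph) → Weights G → Set
NonNeg G w = ∀ e → 0ℚ ≤ w e

walkWeight : ∀ {G u v} → Weights G → Walk G u v → ℚ
walkWeight w []              = 0ℚ
walkWeight w ((e , _) ∷ p)   = w e + walkWeight w p

IsDist : (G : Graph) → Weights G → Fin (n G) → ℚ → Set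
IsDist G w v d = (Σ (Walk G (s G) v) λ p → walkWeight w p ≡ d)
               × (∀ (p : Walk G (s G) v) → d ≤ walkWeight w p)

-- Ancestor G par a v : following the parent pointers par from v reaches a
-- (reflexively), i.e. v is a descendant of a in the rooted tree.
data Ancestor (G : Graph) (par : Fin (n G) → Fin (n G)) : Fin (n G) → Fin (n G) → Set where
  here : ∀ {v} → Ancestor G par v v
  up   : ∀ {a v} → v ≢ s G → Ancestor G par a (par v) → Ancestor G par a v

record SpanningTree (G : Graph) : Set where
  field
    parent     : Fin (n G) → Fin (n G)
    parentEdge : (v : Fin (n G)) → v ≢ s G → Σ (Fin (m G)) λ e → Step G e (parent v) v
    rooted     : ∀ (v : Fin (n G)) → Ancestor G parent (s G) v

open SpanningTree public

LinearOrder : Graph → Set₁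
LinearOrder G = Σ (Rel (Fin (n G)) 0ℓ) λ _≺_ → IsStrictTotalOrder _≡_ _≺_

IsLinearizationOfTree : (G : Graph) → LinearOrder G → SpanningTree G → Set
IsLinearizationOfTree G (_≺_ , _) T = ∀ u v → u ≺ v → ¬ Ancestor G (parent T) v u

IsLinearization : (G : Graph) → LinearOrder G → Set
IsLinearization G L = Σ (SpanningTree G) λ T → IsLinearizationOfTree G L T

DistanceRealizable : (G : Graph) → LinearOrder G → Set
DistanceRealizable G (_≺_ , _) =
  Σ (Weights G) λ w → NonNeg G w ×
  (Σ (Fin (n G) → ℚ) λ d → (∀ v → IsDist G w v (d v))
     × (∀ u v → u ≢ v → d u ≢ d v)
     × (∀ u v → (u ≺ v) ⇔ (d u < d v)))

-- If L linearizes a spanning tree T, weigh every edge by the difference of the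
-- L-positions of its endpoints.  Positions are then 1-Lipschitz along every edge,
-- so no walk s → v is lighter than the position of v, while along T positions
-- increase and the tree path has weight exactly that position: the distances are
-- the positions.  Conversely, if the distances realize L, give every v ≠ s the
-- vertex just before the first arrival at v on a shortest walk as its parent.
-- With nonnegative weights the parent is no farther from s than v, hence strictly
-- closer since distances are distinct; so parents precede their children in L,
-- the parent pointers reach s, and no vertex precedes one of its ancestors.
module Submission where

open import Defs
open import Level using (0ℓ)
open import Function.Base using (_∘_)
open import Function.Bundles using (_⇔_; mk⇔; Equivalence)
open import Data.Nat.Base as ℕ using (ℕ; zero; suc; ∣_-_∣; s≤s)
import Data.Nat.Properties as ℕₚ
open import Data.Nat.Induction using (<-wellFounded)
open import Data.Fin.Base using (Fin)
open import Data.Fin.Properties using (_≟_)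
open import Data.Fin.Subset using (Subset; ∣_∣; _∈_)
open import Data.Fin.Subset.Properties using (p⊂q⇒∣p∣<∣q∣; Empty-unique; ∣⊥∣≡0)
open import Data.Vec.Base using (tabulate)
open import Data.Vec.Properties using (lookup∘tabulate; []=⇒lookup; lookup⇒[]=)
open import Data.Product using (Σ; _×_; _,_; proj₁; proj₂)
open import Data.Sum using (inj₁; inj₂)
open import Data.Empty using (⊥-elim)
open import Data.Rational.Base using (ℚ; 0ℚ; 1ℚ; _+_; _≤_; _<_)
import Data.Rational.Properties as ℚₚ
open import Relation.Binary.Core using (Rel)
open import Relation.Binary.Definitions using (tri<; tri≈; tri>)
open import Relation.Binary.Structures using (IsStrictTotalOrder)
import Relation.Binary.Construct.On as On
open import Relation.Binary.PropositionalEquality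
open import Relation.Nullary using (¬_; does; yes; no)
open import Relation.Nullary.Decidable using (dec-true)
open import Induction.WellFounded using (WellFounded; Acc; acc; module Subrelation)

fromℕ : ℕ → ℚ
fromℕ zero    = 0ℚ
fromℕ (suc k) = 1ℚ + fromℕ k

fromℕ-+ : ∀ a b → fromℕ (a ℕ.+ b) ≡ fromℕ a + fromℕ b
fromℕ-+ zero    b = sym (ℚₚ.+-identityˡ (fromℕ b))
fromℕ-+ (suc a) b = trans (cong (1ℚ +_) (fromℕ-+ a b)) (sym (ℚₚ.+-assoc 1ℚ (fromℕ a) (fromℕ b)))

fromℕ-<-suc : ∀ k → fromℕ k < fromℕ (suc k)
fromℕ-<-suc k = subst (_< 1ℚ + fromℕ k) (ℚₚ.+-identityˡ (fromℕ k))
                      (ℚₚ.+-monoˡ-< (fromℕ k) (ℚₚ.positive⁻¹ 1ℚ))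

fromℕ-mono-< : ∀ {a b} → a ℕ.< b → fromℕ a < fromℕ b
fromℕ-mono-< {a} {suc b} (s≤s a≤b) with ℕₚ.m≤n⇒m<n∨m≡n a≤b
... | inj₁ a<b  = ℚₚ.<-trans (fromℕ-mono-< a<b) (fromℕ-<-suc b)
... | inj₂ refl = fromℕ-<-suc a

fromℕ-mono-≤ : ∀ {a b} → a ℕ.≤ b → fromℕ a ≤ fromℕ b
fromℕ-mono-≤ a≤b with ℕₚ.m≤n⇒m<n∨m≡n a≤b
... | inj₁ a<b  = ℚₚ.<⇒≤ (fromℕ-mono-< a<b)
... | inj₂ refl = ℚₚ.≤-refl

fromℕ-nonNeg : ∀ k → 0ℚ ≤ fromℕ k
fromℕ-nonNeg k = fromℕ-mono-≤ {0} {k} ℕ.z≤n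

p≤p+q : ∀ p {q} → 0ℚ ≤ q → p ≤ p + q
p≤p+q p {q} 0≤q = subst (_≤ p + q) (ℚₚ.+-identityʳ p) (ℚₚ.+-monoʳ-≤ p 0≤q)

module _ {a b ℓ₁ ℓ₂} {A : Set a} {B : Set b} {_<₁_ : Rel A ℓ₁} {_<₂_ : Rel B ℓ₂}
         (sto₁ : IsStrictTotalOrder _≡_ _<₁_) (sto₂ : IsStrictTotalOrder _≡_ _<₂_)
         {f : A → B} (mono : ∀ {x y} → x <₁ y → f x <₂ f y) where
  private
    module O₁ = IsStrictTotalOrder sto₁
    module O₂ = IsStrictTotalOrder sto₂

  strictMono⇒reflects : ∀ {x y} → f x <₂ f y → x <₁ y
  strictMono⇒reflects {x} {y} fx<fy with O₁.compare x y
  ... | tri< x<y _ _ = x<y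
  ... | tri≈ _ refl _ = ⊥-elim (O₂.irrefl refl fx<fy)
  ... | tri> _ _ y<x = ⊥-elim (O₂.asym fx<fy (mono y<x))

  strictMono⇒injective : ∀ {x y} → f x ≡ f y → x ≡ y
  strictMono⇒injective {x} {y} fx≡fy with O₁.compare x y
  ... | tri< x<y _ _ = ⊥-elim (O₂.irrefl fx≡fy (mono x<y))
  ... | tri≈ _ x≡y _ = x≡y
  ... | tri> _ _ y<x = ⊥-elim (O₂.irrefl (sym fx≡fy) (mono y<x))

module Rank {n} {_≺_ : Rel (Fin n) 0ℓ} (sto : IsStrictTotalOrder _≡_ _≺_) where
  open IsStrictTotalOrder sto using (_<?_) renaming (trans to ≺-trans; irrefl to ≺-irrefl)

  below : Fin n → Subset n
  below v = tabulate (λ u → does (u <? v))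

  ∈below⇒≺ : ∀ {u v} → u ∈ below v → u ≺ v
  ∈below⇒≺ {u} {v} u∈ with u <? v | trans (sym (lookup∘tabulate (λ x → does (x <? v)) u)) ([]=⇒lookup u∈)
  ... | yes u≺v | _ = u≺v
  ... | no _    | ()

  ≺⇒∈below : ∀ {u v} → u ≺ v → u ∈ below v
  ≺⇒∈below {u} {v} u≺v =
    lookup⇒[]= u (below v) (trans (lookup∘tabulate (λ x → does (x <? v)) u) (dec-true (u <? v) u≺v))

  rank : Fin n → ℕ
  rank v = ∣ below v ∣

  rank-mono : ∀ {u v} → u ≺ v → rank u ℕ.< rank v
  rank-mono {u} u≺v = p⊂q⇒∣p∣<∣q∣
    ( (λ x∈ → ≺⇒∈below (≺-trans (∈below⇒≺ x∈) u≺v))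
    , u , ≺⇒∈below u≺v , (λ u∈ → ≺-irrefl refl (∈below⇒≺ u∈)) )

  rank-minimum : ∀ {v} → (∀ u → ¬ u ≺ v) → rank v ≡ 0
  rank-minimum minimal =
    trans (cong ∣_∣ (Empty-unique λ (u , u∈) → minimal u (∈below⇒≺ u∈))) (∣⊥∣≡0 n)

  ≺-wellFounded : WellFounded _≺_
  ≺-wellFounded = Subrelation.wellFounded rank-mono (On.wellFounded rank <-wellFounded)

module _ {G : Graph} where
  private
    V = Fin (n G)
    Edge = Fin (m G)

  _▷_ : ∀ {u x y} → Walk G u x → (Σ Edge λ e → Step G e x y) → Walk G u y
  []      ▷ st = st ∷ []
  (h ∷ p) ▷ st = h ∷ (p ▷ st)

  walkWeight-▷ : ∀ (w : Weights G) {u x y} (p : Walk G u x) (st : Σ Edge λ e → Step G e x y) →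
                 walkWeight w (p ▷ st) ≡ walkWeight w p + w (proj₁ st)
  walkWeight-▷ w []            (e , _) = trans (ℚₚ.+-identityʳ (w e)) (sym (ℚₚ.+-identityˡ (w e)))
  walkWeight-▷ w ((e , _) ∷ p) st      =
    trans (cong (w e +_) (walkWeight-▷ w p st)) (sym (ℚₚ.+-assoc (w e) _ _))

  walkWeight-nonNeg : ∀ {w} → NonNeg G w → ∀ {u v} (p : Walk G u v) → 0ℚ ≤ walkWeight w p
  walkWeight-nonNeg w≥0 []            = ℚₚ.≤-refl
  walkWeight-nonNeg w≥0 ((e , _) ∷ p) = ℚₚ.≤-trans (w≥0 e) (p≤p+q _ (walkWeight-nonNeg w≥0 p))

  potential-≤-walkWeight : ∀ (w : Weights G) (φ : V → ℚ) →
    (∀ {e u v} → Step G e u v → φ v ≤ φ u + w e) →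
    ∀ {u v} (p : Walk G u v) → φ v ≤ φ u + walkWeight w p
  potential-≤-walkWeight w φ step {u} [] = ℚₚ.≤-reflexive (sym (ℚₚ.+-identityʳ (φ u)))
  potential-≤-walkWeight w φ step {u} {v} ((e , st) ∷ p) = begin
    φ v                            ≤⟨ potential-≤-walkWeight w φ step p ⟩
    φ _ + walkWeight w p           ≤⟨ ℚₚ.+-monoˡ-≤ (walkWeight w p) (step st) ⟩
    φ u + w e + walkWeight w p     ≡⟨ ℚₚ.+-assoc (φ u) (w e) (walkWeight w p) ⟩
    φ u + (w e + walkWeight w p)   ∎
    where open ℚₚ.≤-Reasoning

  firstEntry : ∀ {w} → NonNeg G w → ∀ {x v} (p : Walk G x v) → x ≢ v →
    Σ V λ u → u ≢ v × Σ Edge λ e → Step G e u v ×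
      Σ (Walk G x u) λ q → walkWeight w q + w e ≤ walkWeight w p
  firstEntry w≥0 [] x≢x = ⊥-elim (x≢x refl)
  firstEntry {w} w≥0 {x} {v} (_∷_ {v = y} (e , st) p) x≢v with y ≟ v
  ... | yes refl = x , x≢v , e , st , [] ,
        subst (_≤ w e + walkWeight w p) (sym (ℚₚ.+-identityˡ (w e)))
              (p≤p+q (w e) (walkWeight-nonNeg w≥0 p))
  ... | no y≢v with firstEntry w≥0 p y≢v
  ... | u , u≢v , e′ , st′ , q , q+e′≤p = u , u≢v , e′ , st′ , (e , st) ∷ q , (begin
        w e + walkWeight w q + w e′     ≡⟨ ℚₚ.+-assoc (w e) (walkWeight w q) (w e′) ⟩
        w e + (walkWeight w q + w e′)   ≤⟨ ℚₚ.+-monoʳ-≤ (w e) q+e′≤p ⟩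
        w e + walkWeight w p            ∎)
    where open ℚₚ.≤-Reasoning

edgeGap : (G : Graph) → (Fin (n G) → ℕ) → Fin (m G) → ℕ
edgeGap G h e = ∣ h (tgt G e) - h (src G e) ∣

module _ (G : Graph) where

  edgeGap-≤ : ∀ h {e u v} → Step G e u v → h v ℕ.≤ h u ℕ.+ edgeGap G h e
  edgeGap-≤ h {u = u} {v} (inj₁ (refl , refl))     = ℕₚ.m≤n+∣m-n∣ (h v) (h u)
  edgeGap-≤ h {u = u} {v} (inj₂ (_ , refl , refl)) = ℕₚ.m≤n+∣n-m∣ (h v) (h u)

  edgeGap-tight : ∀ h {e u v} → Step G e u v → h u ℕ.≤ h v → h u ℕ.+ edgeGap G h e ≡ h v
  edgeGap-tight h {u = u} (inj₁ (refl , refl)) hu≤hv =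
    trans (cong (h u ℕ.+_) (ℕₚ.m≤n⇒∣n-m∣≡n∸m hu≤hv)) (ℕₚ.m+[n∸m]≡n hu≤hv)
  edgeGap-tight h {u = u} (inj₂ (_ , refl , refl)) hu≤hv =
    trans (cong (h u ℕ.+_) (ℕₚ.m≤n⇒∣m-n∣≡n∸m hu≤hv)) (ℕₚ.m+[n∸m]≡n hu≤hv)

module Linearization⇒Realizable (G : Graph) {_≺_ : Rel (Fin (n G)) 0ℓ}
    (sto : IsStrictTotalOrder _≡_ _≺_) (T : SpanningTree G)
    (lin : IsLinearizationOfTree G (_≺_ , sto) T) where
  open Rank sto
  open IsStrictTotalOrder sto using (compare)

  w : Weights G
  w = fromℕ ∘ edgeGap G rank

  d : Fin (n G) → ℚ
  d = fromℕ ∘ rank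

  d-mono : ∀ {u v} → u ≺ v → d u < d v
  d-mono = fromℕ-mono-< ∘ rank-mono

  rank-source : rank (s G) ≡ 0
  rank-source = rank-minimum λ u u≺s → lin u (s G) u≺s (rooted T u)

  rank-parent : ∀ v → v ≢ s G → rank (parent T v) ℕ.≤ rank v
  rank-parent v v≢s with compare (parent T v) v
  ... | tri< p≺v _ _ = ℕₚ.<⇒≤ (rank-mono p≺v)
  ... | tri≈ _ p≡v _ = ℕₚ.≤-reflexive (cong rank p≡v)
  ... | tri> _ _ v≺p = ⊥-elim (lin v (parent T v) v≺p (up v≢s here))

  d-step : ∀ {e u v} → Step G e u v → d v ≤ d u + w e
  d-step {e} {u} st = ℚₚ.≤-trans (fromℕ-mono-≤ (edgeGap-≤ G rank st))
                                 (ℚₚ.≤-reflexive (fromℕ-+ (rank u) (edgeGap G rank e)))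

  d-≤-walkWeight : ∀ {v} (p : Walk G (s G) v) → d v ≤ walkWeight w p
  d-≤-walkWeight {v} p = begin
    d v                        ≤⟨ potential-≤-walkWeight w d d-step p ⟩
    d (s G) + walkWeight w p   ≡⟨ cong (λ r → fromℕ r + walkWeight w p) rank-source ⟩
    0ℚ + walkWeight w p        ≡⟨ ℚₚ.+-identityˡ (walkWeight w p) ⟩
    walkWeight w p             ∎
    where open ℚₚ.≤-Reasoning

  treeWalk : ∀ {v} → Ancestor G (parent T) (s G) v →
             Σ (Walk G (s G) v) λ p → walkWeight w p ≡ d v
  treeWalk here = [] , cong fromℕ (sym rank-source)
  treeWalk {v} (up v≢s anc) with treeWalk anc
  ... | p , p≡d = p ▷ parentEdge T v v≢s , (begin
      walkWeight w (p ▷ parentEdge T v v≢s)     ≡⟨ walkWeight-▷ w p (parentEdge T v v≢s) ⟩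
      walkWeight w p + w e                      ≡⟨ cong (_+ w e) p≡d ⟩
      fromℕ (rank (parent T v)) + w e           ≡⟨ fromℕ-+ (rank (parent T v)) gap ⟨
      fromℕ (rank (parent T v) ℕ.+ gap)         ≡⟨ cong fromℕ (edgeGap-tight G rank st (rank-parent v v≢s)) ⟩
      d v                                       ∎)
    where
    open ≡-Reasoning
    e = proj₁ (parentEdge T v v≢s)
    st = proj₂ (parentEdge T v v≢s)
    gap = edgeGap G rank e

  realizable : DistanceRealizable G (_≺_ , sto)
  realizable =
    w , fromℕ-nonNeg ∘ edgeGap G rank , d ,
    (λ v → treeWalk (rooted T v) , d-≤-walkWeight) ,
    (λ u v u≢v → u≢v ∘ strictMono⇒injective sto ℚₚ.<-isStrictTotalOrder d-mono) ,
    (λ u v → mk⇔ d-mono (strictMono⇒reflects sto ℚₚ.<-isStrictTotalOrder d-mono))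

module Realizable⇒Linearization (G : Graph) {_≺_ : Rel (Fin (n G)) 0ℓ}
    (sto : IsStrictTotalOrder _≡_ _≺_) (w : Weights G) (w≥0 : NonNeg G w)
    (d : Fin (n G) → ℚ) (isDist : ∀ v → IsDist G w v (d v))
    (d-injective : ∀ u v → u ≢ v → d u ≢ d v) (≺⇔< : ∀ u v → (u ≺ v) ⇔ (d u < d v)) where
  open Rank sto using (≺-wellFounded)

  private
    V = Fin (n G)

  closerPredecessor : ∀ v → v ≢ s G → Σ V λ u → Σ (Fin (m G)) λ e → Step G e u v × d u < d v
  closerPredecessor v v≢s with proj₁ (isDist v)
  ... | p , p≡dv with firstEntry w≥0 p (v≢s ∘ sym)
  ... | u , u≢v , e , st , q , q+e≤p = u , e , st , du<dv
    where
    du≤dv : d u ≤ d v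
    du≤dv = begin
      d u                    ≤⟨ proj₂ (isDist u) q ⟩
      walkWeight w q         ≤⟨ p≤p+q _ (w≥0 e) ⟩
      walkWeight w q + w e   ≤⟨ q+e≤p ⟩
      walkWeight w p         ≡⟨ p≡dv ⟩
      d v                    ∎
      where open ℚₚ.≤-Reasoning
    du<dv : d u < d v
    du<dv with ℚₚ.<-cmp (d u) (d v)
    ... | tri< du<dv _ _ = du<dv
    ... | tri≈ _ du≡dv _ = ⊥-elim (d-injective u v u≢v du≡dv)
    ... | tri> _ _ dv<du = ⊥-elim (ℚₚ.<-irrefl refl (ℚₚ.<-≤-trans dv<du du≤dv))

  parentOf : V → V
  parentOf v with v ≟ s G
  ... | yes _   = s G
  ... | no v≢s = proj₁ (closerPredecessor v v≢s)

  parentEdgeOf : ∀ v → v ≢ s G → Σ (Fin (m G)) λ e → Step G e (parentOf v) v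
  parentEdgeOf v v≢s with v ≟ s G
  ... | yes v≡s  = ⊥-elim (v≢s v≡s)
  ... | no v≢s′ = let _ , e , st , _ = closerPredecessor v v≢s′ in e , st

  parentOf-closer : ∀ v → v ≢ s G → d (parentOf v) < d v
  parentOf-closer v v≢s with v ≟ s G
  ... | yes v≡s  = ⊥-elim (v≢s v≡s)
  ... | no v≢s′ = let _ , _ , _ , closer = closerPredecessor v v≢s′ in closer

  reachesSource : ∀ v → Acc _≺_ v → Ancestor G parentOf (s G) v
  reachesSource v (acc rs) with v ≟ s G
  ... | yes refl = here
  ... | no v≢s  =
    up v≢s (reachesSource (parentOf v) (rs (Equivalence.from (≺⇔< _ v) (parentOf-closer v v≢s))))

  tree : SpanningTree G
  tree = record { parent = parentOf ; parentEdge = parentEdgeOf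
                ; rooted = λ v → reachesSource v (≺-wellFounded v) }

  ancestor-≤ : ∀ {a x} → Ancestor G parentOf a x → d a ≤ d x
  ancestor-≤ here                = ℚₚ.≤-refl
  ancestor-≤ {x = x} (up x≢s anc) = ℚₚ.≤-trans (ancestor-≤ anc) (ℚₚ.<⇒≤ (parentOf-closer x x≢s))

  linearization : IsLinearization G (_≺_ , sto)
  linearization = tree , λ u v u≺v v-anc-u →
    ℚₚ.<-irrefl refl (ℚₚ.<-≤-trans (Equivalence.to (≺⇔< u v) u≺v) (ancestor-≤ v-anc-u))

mainTheorem7 : (G : Graph) → AllReachable G → (L : LinearOrder G) →
    IsLinearization G L ⇔ DistanceRealizable G L
mainTheorem7 G _ (_≺_ , sto) = mk⇔
  (λ (T , lin) → Linearization⇒Realizable.realizable G sto T lin)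
  (λ (w , w≥0 , d , isDist , d-injective , ≺⇔<) →
     Realizable⇒Linearization.linearization G sto w w≥0 d isDist d-injective ≺⇔<)
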